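{- Let $X$ be an ordered set and let $M\subseteq X$ be an almost dense, bicofinal subset of $X$. Let $x,y\in X$. If for all $a,b\in M$ we have ($a\leq x\leq b$ if and only if $a\leq y\leq b$), then $x=y$.
   Context: All reasoning is constructive (no law of excluded middle). An ordered set is a set $X$ with a binary relation $<$ satisfying, for all $x,y,z$: asymmetry ($x<y$ implies not $y<x$), cotransitivity ($x<y$ implies $x<z$ or $z<y$), and negative antisymmetry (not $x<y$ and not $y<x$ imply $x=y$). Write $x\leq y$ for "not $y<x$". A subset $S\subseteq X$ is almost dense in $X$ if whenever $x<y$ in $X$ there are $s,s'\in S$ with $x\leq s<s'\leq y$; it is bicofinal in $X$ if for each $x\in X$ there are $s,s'\in S$ with $s\leq x\leq s'$. -}

module Defs where

open import Level using (Level; _⊔_; suc)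
open import Data.Product using (Σ; _×_; _,_)
open import Data.Sum using (_⊎_)
open import Relation.Nullary using (¬_)
open import Relation.Binary.PropositionalEquality using (_≡_)

record OrderedSet (c ℓ : Level) : Set (suc (c ⊔ ℓ)) where
  infix 4 _<_ _≤_
  field
    Carrier   : Set c
    _<_       : Carrier → Carrier → Set ℓ
    asym      : ∀ {x y} → x < y → ¬ (y < x)
    cotrans   : ∀ {x y} → x < y → ∀ z → (x < z) ⊎ (z < y)
    neg-antisym : ∀ {x y} → ¬ (x < y) → ¬ (y < x) → x ≡ y

  _≤_ : Carrier → Carrier → Set ℓ
  x ≤ y = ¬ (y < x)

module _ {c ℓ : Level} (X : OrderedSet c ℓ) where
  open OrderedSet X

  AlmostDense : {p : Level} → (Carrier → Set p) → Set (c ⊔ ℓ ⊔ p)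
  AlmostDense S = ∀ x y → x < y →
    Σ Carrier λ s → Σ Carrier λ s' → S s × S s' × (x ≤ s) × (s < s') × (s' ≤ y)

  Bicofinal : {p : Level} → (Carrier → Set p) → Set (c ⊔ p ⊔ ℓ)
  Bicofinal S = ∀ x →
    Σ Carrier λ s → Σ Carrier λ s' → S s × S s' × (s ≤ x) × (x ≤ s')

module Submission where

open import Defs
open import Level using (Level; _⊔_)
open import Data.Product using (_×_; _,_; proj₂)
open import Data.Sum using (inj₁; inj₂)
open import Function.Bundles using (_⇔_; Equivalence)
open import Relation.Nullary using (¬_)
open import Relation.Binary.PropositionalEquality using (_≡_)

module _ {c ℓ : Level} (X : OrderedSet c ℓ) where
  open OrderedSet X

  IntervalsFollow : {p : Level} → (Carrier → Set p) → Carrier → Carrier → Set (c ⊔ ℓ ⊔ p)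
  IntervalsFollow S x y =
    (a b : Carrier) → S a → S b → (a ≤ x × x ≤ b) → (a ≤ y × y ≤ b)

  -- From x < y take s < s' in S between them; cotransitivity puts y either
  -- above s, so that an interval [a, s] around x misses y, or below s' ≤ y.
  intervalsFollow⇒≮ : {p : Level} {S : Carrier → Set p} →
    AlmostDense X S → Bicofinal X S →
    ∀ {x y} → IntervalsFollow S x y → ¬ (x < y)
  intervalsFollow⇒≮ dense cofinal {x} {y} follow x<y
    with dense x y x<y | cofinal x
  ... | s , s' , Ss , _ , x≤s , s<s' , s'≤y | a , _ , Sa , _ , a≤x , _
    with cotrans s<s' y
  ... | inj₁ s<y  = proj₂ (follow a s Sa Ss (a≤x , x≤s)) s<y
  ... | inj₂ y<s' = s'≤y y<s'

lemma10 : {c ℓ p : Level} (X : OrderedSet c ℓ) (M : OrderedSet.Carrier X → Set p) →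
          AlmostDense X M → Bicofinal X M →
          (x y : OrderedSet.Carrier X) →
          ((a b : OrderedSet.Carrier X) → M a → M b →
            ((OrderedSet._≤_ X a x × OrderedSet._≤_ X x b) ⇔ (OrderedSet._≤_ X a y × OrderedSet._≤_ X y b))) →
          x ≡ y
lemma10 X M dense cofinal x y sameIntervals = OrderedSet.neg-antisym X
  (intervalsFollow⇒≮ X dense cofinal (λ a b Ma Mb → Equivalence.to (sameIntervals a b Ma Mb)))
  (intervalsFollow⇒≮ X dense cofinal (λ a b Ma Mb → Equivalence.from (sameIntervals a b Ma Mb)))
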